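{- For every $n\geq 4$, every even permutation on $[n]$ has at least two different factorizations into a product of two $n$-cycles, i.e. there are at least two distinct ordered pairs $(\sigma,\tau)$ of $n$-cycles on $[n]$ with $\sigma\circ\tau$ equal to the given permutation. -}

module Defs where

open import Data.Nat using (ℕ; zero; suc; _<_; _+_)
open import Data.Nat.Properties using ()
open import Data.Fin using (Fin) renaming (_<_ to _<ᶠ_)
open import Data.Fin.Properties using (_<?_)
open import Data.Fin.Permutation using (Permutation′; _⟨$⟩ʳ_)
open import Data.List using (List; length; filter; cartesianProduct)
open import Data.List.Base using (allFin)
open import Data.Product using (Σ; ∃; _×_; _,_; proj₁; proj₂)
open import Relation.Binary.PropositionalEquality using (_≡_)
open import Relation.Nullary using (¬_)
open import Relation.Nullary.Decidable using (_×-dec_)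

Perm : ℕ → Set
Perm n = Permutation′ n

iter : ∀ {A : Set} → (A → A) → ℕ → A → A
iter f zero    x = x
iter f (suc k) x = f (iter f k x)

-- σ is an n-cycle on [n]: some point x whose orbit x, σx, …, σ^{n-1}x
-- exhausts all of [n] (i.e. σ consists of a single cycle of length n).
IsFullCycle : ∀ {n} → Perm n → Set
IsFullCycle {n} σ =
  ∃ λ (x : Fin n) → (y : Fin n) → ∃ λ k → k < n × iter (σ ⟨$⟩ʳ_) k x ≡ y

inversions : ∀ {n} → Perm n → List (Fin n × Fin n)
inversions {n} π =
  filter (λ p → (proj₁ p <? proj₂ p) ×-dec ((π ⟨$⟩ʳ proj₂ p) <? (π ⟨$⟩ʳ proj₁ p)))
         (cartesianProduct (allFin n) (allFin n))

data Even : ℕ → Set where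
  even-zero : Even zero
  even-ss   : ∀ {m} → Even m → Even (suc (suc m))

IsEven : ∀ {n} → Perm n → Set
IsEven π = Even (length (inversions π))

_≐_ : ∀ {n} → Perm n → Perm n → Set
_≐_ {n} σ τ = (x : Fin n) → σ ⟨$⟩ʳ x ≡ τ ⟨$⟩ʳ x

Factorises : ∀ {n} → Perm n → Perm n → Perm n → Set
Factorises {n} π σ τ = (x : Fin n) → σ ⟨$⟩ʳ (τ ⟨$⟩ʳ x) ≡ π ⟨$⟩ʳ x

CycleFactorisation : ∀ {n} → Perm n → Set
CycleFactorisation {n} π =
  Σ (Perm n × Perm n) λ st →
    IsFullCycle (proj₁ st) × IsFullCycle (proj₂ st) × Factorises π (proj₁ st) (proj₂ st)

{-# OPTIONS --safe #-}
-- Induction on n, inserting a new point 0 into both cycles of a factorisation of a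
-- permutation of the remaining points (Fin (2 + m) is 0 plus a suc-shifted Fin (1 + m)).
-- If the even π fixes 0, its restriction ρ is even; factor ρ = σ ∘ τ and insert 0 into
-- the cycle of σ after τ d and into the cycle of τ after d. If π 0 = suc w, then
-- π = (0 suc w) ∘ lift₀ ρ with ρ odd; let x be the point with π (suc x) = 0, take any
-- d ≢ x, factor the even ρ ∘ (x d) = σ ∘ τ and insert 0 after τ x and after d. Either
-- way the new τ sends suc d to 0, so two choices of d with π (suc d) ≢ 0, which exist
-- once n ≥ 4, give two different factorisations.
--
-- Evenness is the parity of the inversion count. Composing with a transposition flips
-- it: an adjacent transposition changes exactly one inversion, and any other one is the
-- conjugate of a shorter one by an adjacent one.

module Submission where

open import Defs
open import Data.Bool using (Bool; true; false; not; if_then_else_; _∧_)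
open import Data.Bool.Properties using (∧-zeroʳ)
open import Data.Empty using (⊥-elim)
open import Data.Fin using (Fin; zero; suc; toℕ; inject₁; _<_)
open import Data.Fin.Patterns using (0F; 1F; 2F)
open import Data.Fin.Permutation
  using ( _⟨$⟩ʳ_; _⟨$⟩ˡ_; _∘ₚ_; _≈_; id; transpose; lift₀; remove
        ; lift₀-remove; lift₀-comp; lift₀-transpose; inverseˡ; inverseʳ )
import Data.Fin.Permutation.Components as PC
open import Data.Fin.Properties
  using (_≟_; _<?_; <-cmp; <-irrefl; <-asym; <⇒≢; 0≢1+n; toℕ-injective; toℕ-inject₁; suc-injective)
open import Data.List using (List; []; _∷_; _++_; map; length; filter; cartesianProduct; allFin)
open import Data.List.Membership.Propositional using (_∈_)
open import Data.List.Membership.Propositional.Properties using (∈-cartesianProduct⁺; ∈-allFin)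
open import Data.List.Properties using (map-tabulate)
open import Data.List.Relation.Unary.All as All using (All; []; _∷_)
open import Data.List.Relation.Unary.AllPairs using (_∷_)
open import Data.List.Relation.Unary.Any using (here; there)
open import Data.List.Relation.Unary.Unique.Propositional using (Unique)
open import Data.List.Relation.Unary.Unique.Propositional.Properties using (cartesianProduct⁺; allFin⁺)
open import Data.Nat as ℕ using (ℕ; zero; suc; _+_; _≤_; parity)
import Data.Nat.Properties as ℕ
open import Data.Parity.Base using (Parity; 0ℙ; _⁻¹)
open import Data.Parity.Properties using (suc-homo-⁻¹; ⁻¹-selfInverse; ⁻¹-involutive; p≢p⁻¹)
open import Data.Product using (Σ; ∃; _×_; _,_; proj₁; proj₂)
open import Function using (_∘_; _⇔_; mk⇔; Injective)
open import Function.Bundles using (Injection)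
open import Function.Construct.Identity using (⇔-id)
open import Function.Construct.Symmetry using (⇔-sym)
open import Function.Properties.Inverse using (↔⇒↣)
open import Relation.Binary using (Tri; tri<; tri≈; tri>)
open import Relation.Binary.PropositionalEquality
open import Relation.Nullary using (Dec; yes; no; does; ¬_)
open import Relation.Nullary.Decidable using (dec-true; dec-false; does-⇔)
open import Relation.Unary using (Decidable)

count : ∀ {A : Set} → (A → Bool) → List A → ℕ
count p []       = 0
count p (x ∷ xs) = if p x then suc (count p xs) else count p xs

length-filter : ∀ {A : Set} {P : A → Set} (P? : Decidable P) xs →
                length (filter P? xs) ≡ count (does ∘ P?) xs
length-filter P? []       = refl
length-filter P? (x ∷ xs) with does (P? x)
... | true  = cong suc (length-filter P? xs)
... | false = length-filter P? xs

count-++ : ∀ {A : Set} (p : A → Bool) xs ys → count p (xs ++ ys) ≡ count p xs + count p ys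
count-++ p []       ys = refl
count-++ p (x ∷ xs) ys with p x
... | true  = cong suc (count-++ p xs ys)
... | false = count-++ p xs ys

count-map : ∀ {A B : Set} (p : A → Bool) (f : B → A) xs → count p (map f xs) ≡ count (p ∘ f) xs
count-map p f []       = refl
count-map p f (x ∷ xs) with p (f x)
... | true  = cong suc (count-map p f xs)
... | false = count-map p f xs

count-cong : ∀ {A : Set} {p q : A → Bool} {xs} → All (λ x → p x ≡ q x) xs → count p xs ≡ count q xs
count-cong []                              = refl
count-cong {q = q} {x ∷ _} (px≡qx ∷ eqs) rewrite px≡qx with q x
... | true  = cong suc (count-cong eqs)
... | false = count-cong eqs

count-none : ∀ {A : Set} {p : A → Bool} {xs} → All (λ x → p x ≡ false) xs → count p xs ≡ 0
count-none []                = refl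
count-none (px≡false ∷ none) rewrite px≡false = count-none none

parity-suc : ∀ n → parity (suc n) ≡ parity n ⁻¹
parity-suc n = sym (⁻¹-selfInverse (suc-homo-⁻¹ n))

parity-count-flip : ∀ {A : Set} {p q : A → Bool} {e xs} → Unique xs → e ∈ xs →
                    p e ≡ not (q e) → (∀ {x} → x ≢ e → p x ≡ q x) →
                    parity (count p xs) ≡ parity (count q xs) ⁻¹
parity-count-flip {p = p} {q} {xs = e ∷ xs} (e∉xs ∷ _) (here refl) pe≡¬qe agree
  with p e | q e | pe≡¬qe | count-cong {p = p} {q} (All.map (λ e≢x → agree (e≢x ∘ sym)) e∉xs)
... | true  | false | _ | same = trans (parity-suc (count p xs)) (cong (λ c → parity c ⁻¹) same)
... | false | true  | _ | same = trans (cong parity same) (sym (suc-homo-⁻¹ (count q xs)))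
parity-count-flip {p = p} {q} {xs = x ∷ xs} (x∉xs ∷ unique) (there e∈xs) pe≡¬qe agree
  with p x | q x | agree (All.lookup x∉xs e∈xs) | parity-count-flip unique e∈xs pe≡¬qe agree
... | true  | true  | _ | flipped = begin
  parity (suc (count p xs))     ≡⟨ parity-suc (count p xs) ⟩
  parity (count p xs) ⁻¹        ≡⟨ cong _⁻¹ flipped ⟩
  parity (count q xs) ⁻¹ ⁻¹     ≡⟨ cong _⁻¹ (parity-suc (count q xs)) ⟨
  parity (suc (count q xs)) ⁻¹  ∎
  where open ≡-Reasoning
... | false | false | _ | flipped = flipped

permute-injective : ∀ {n} (π : Perm n) → Injective _≡_ _≡_ (π ⟨$⟩ʳ_)
permute-injective π = Injection.injective (↔⇒↣ π)

data TransposeView {n} (i j : Fin n) : Fin n → Set where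
  at-i      : TransposeView i j i
  at-j      : TransposeView i j j
  elsewhere : ∀ {k} → k ≢ i → k ≢ j → TransposeView i j k

transposeView : ∀ {n} (i j k : Fin n) → TransposeView i j k
transposeView i j k with k ≟ i | k ≟ j
... | yes refl | _        = at-i
... | no _     | yes refl = at-j
... | no k≢i   | no k≢j   = elsewhere k≢i k≢j

transpose-matchˡ : ∀ {n} (i j : Fin n) → PC.transpose i j i ≡ j
transpose-matchˡ i j rewrite dec-true (i ≟ i) refl = refl

transpose-matchʳ : ∀ {n} (i j : Fin n) → PC.transpose i j j ≡ i
transpose-matchʳ i j with j ≟ i
... | yes refl = refl
... | no _ rewrite dec-true (j ≟ j) refl = refl

transpose-other : ∀ {n} (i j : Fin n) {k} → k ≢ i → k ≢ j → PC.transpose i j k ≡ k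
transpose-other i j {k} k≢i k≢j rewrite dec-false (k ≟ i) k≢i | dec-false (k ≟ j) k≢j = refl

transpose-comm : ∀ {n} (i j k : Fin n) → PC.transpose i j k ≡ PC.transpose j i k
transpose-comm i j k with transposeView i j k
... | at-i              = trans (transpose-matchˡ i j) (sym (transpose-matchʳ j i))
... | at-j              = trans (transpose-matchʳ i j) (sym (transpose-matchˡ j i))
... | elsewhere k≢i k≢j = trans (transpose-other i j k≢i k≢j) (sym (transpose-other j i k≢j k≢i))

transpose-involutive : ∀ {n} (i j k : Fin n) → PC.transpose i j (PC.transpose i j k) ≡ k
transpose-involutive i j k =
  trans (cong (PC.transpose i j) (transpose-comm i j k)) (PC.transpose-inverse i j)

transpose-injective : ∀ {n} (i j : Fin n) → Injective _≡_ _≡_ (PC.transpose i j)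
transpose-injective i j {k} {l} eq = begin
  k                                      ≡⟨ transpose-involutive i j k ⟨
  PC.transpose i j (PC.transpose i j k)  ≡⟨ cong (PC.transpose i j) eq ⟩
  PC.transpose i j (PC.transpose i j l)  ≡⟨ transpose-involutive i j l ⟩
  l                                      ∎
  where open ≡-Reasoning

transpose-conj : ∀ {m n} {f : Fin m → Fin n} → Injective _≡_ _≡_ f → ∀ i j k →
                 f (PC.transpose i j k) ≡ PC.transpose (f i) (f j) (f k)
transpose-conj {f = f} f-inj i j k with transposeView i j k
... | at-i              = trans (cong f (transpose-matchˡ i j)) (sym (transpose-matchˡ (f i) (f j)))
... | at-j              = trans (cong f (transpose-matchʳ i j)) (sym (transpose-matchʳ (f i) (f j)))
... | elsewhere k≢i k≢j = trans (cong f (transpose-other i j k≢i k≢j))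
                                (sym (transpose-other (f i) (f j) (k≢i ∘ f-inj) (k≢j ∘ f-inj)))

transpose-∘-transpose : ∀ {n} {a b c : Fin n} → c ≢ a → c ≢ b → ∀ k →
                        PC.transpose a b (PC.transpose a c k) ≡ PC.transpose b c (PC.transpose a b k)
transpose-∘-transpose {a = a} {b} {c} c≢a c≢b k =
  trans (transpose-conj (transpose-injective a b) a c k)
        (cong₂ (λ i j → PC.transpose i j (PC.transpose a b k)) (transpose-matchˡ a b) (transpose-other a b c≢a c≢b))

pairs : ∀ n → List (Fin n × Fin n)
pairs n = cartesianProduct (allFin n) (allFin n)

pairs-unique : ∀ n → Unique (pairs n)
pairs-unique n = cartesianProduct⁺ (allFin⁺ n) (allFin⁺ n)

∈-pairs : ∀ {n} (i j : Fin n) → (i , j) ∈ pairs n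
∈-pairs i j = ∈-cartesianProduct⁺ (∈-allFin i) (∈-allFin j)

isInversion : ∀ {n} → (Fin n → Fin n) → Fin n × Fin n → Bool
isInversion f (i , j) = does (i <? j) ∧ does (f j <? f i)

permParity : ∀ {n} → Perm n → Parity
permParity {n} π = parity (count (isInversion (π ⟨$⟩ʳ_)) (pairs n))

even⇒parity≡0 : ∀ {m} → Even m → parity m ≡ 0ℙ
even⇒parity≡0 even-zero   = refl
even⇒parity≡0 (even-ss m) = even⇒parity≡0 m

isEven⇒permParity≡0 : ∀ {n} (π : Perm n) → IsEven π → permParity π ≡ 0ℙ
isEven⇒permParity≡0 {n} π even =
  trans (cong parity (sym (length-filter _ (pairs n)))) (even⇒parity≡0 even)

permParity-cong : ∀ {n} (π ρ : Perm n) → π ≈ ρ → permParity π ≡ permParity ρ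
permParity-cong {n} _ _ π≈ρ = cong parity (count-cong {xs = pairs n} (All.tabulate λ {(i , j)} _ →
  cong₂ (λ a b → does (i <? j) ∧ does (a <? b)) (π≈ρ j) (π≈ρ i)))

permParity-Fin1 : (ρ : Perm 1) → permParity ρ ≡ 0ℙ
permParity-Fin1 ρ = refl

permParity-lift₀ : ∀ {n} (ρ : Perm n) → permParity (lift₀ ρ) ≡ permParity ρ
permParity-lift₀ {n} ρ = cong parity (begin
  count inv↑ (pairs (suc n))
    ≡⟨ cong (λ is → count inv↑ (cartesianProduct is is)) allFin-suc ⟩
  count inv↑ (map (zero ,_) row ++ cartesianProduct (map suc (allFin n)) row)
    ≡⟨ count-++ inv↑ (map (zero ,_) row) _ ⟩
  count inv↑ (map (zero ,_) row) + count inv↑ (cartesianProduct (map suc (allFin n)) row)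
    ≡⟨ cong₂ _+_ zero-row (suc-rows (allFin n) (allFin n)) ⟩
  count inv (pairs n) ∎)
  where
  open ≡-Reasoning
  inv  : Fin n × Fin n → Bool
  inv  = isInversion (ρ ⟨$⟩ʳ_)
  inv↑ : Fin (suc n) × Fin (suc n) → Bool
  inv↑ = isInversion (lift₀ ρ ⟨$⟩ʳ_)

  allFin-suc : allFin (suc n) ≡ zero ∷ map suc (allFin n)
  allFin-suc = cong (zero ∷_) (sym (map-tabulate (λ i → i) suc))

  row : List (Fin (suc n))
  row = zero ∷ map suc (allFin n)

  zero-row : count inv↑ (map (zero ,_) row) ≡ 0
  zero-row = trans (count-map inv↑ (zero ,_) row)
                   (count-none (All.universal (λ j → ∧-zeroʳ (does (zero {n} <? j))) row))

  suc-rows : ∀ is js → count inv↑ (cartesianProduct (map suc is) (zero ∷ map suc js))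
                       ≡ count inv (cartesianProduct is js)
  suc-rows []       js = refl
  suc-rows (i ∷ is) js = begin
    count inv↑ (map (suc i ,_) (map suc js) ++ rest↑)
      ≡⟨ count-++ inv↑ (map (suc i ,_) (map suc js)) rest↑ ⟩
    count inv↑ (map (suc i ,_) (map suc js)) + count inv↑ rest↑
      ≡⟨ cong₂ _+_ (trans (count-map inv↑ (suc i ,_) (map suc js)) (count-map _ suc js)) (suc-rows is js) ⟩
    count (inv ∘ (i ,_)) js + count inv (cartesianProduct is js)
      ≡⟨ cong (_+ _) (count-map inv (i ,_) js) ⟨
    count inv (map (i ,_) js) + count inv (cartesianProduct is js)
      ≡⟨ count-++ inv (map (i ,_) js) _ ⟨
    count inv (cartesianProduct (i ∷ is) js) ∎
    where
    rest↑ = cartesianProduct (map suc is) (zero ∷ map suc js)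

permParity-remove-zero : ∀ {n} (π : Perm (suc n)) → π ⟨$⟩ʳ zero ≡ zero →
                         permParity (remove zero π) ≡ permParity π
permParity-remove-zero π π0≡0 =
  trans (sym (permParity-lift₀ (remove zero π)))
        (permParity-cong (lift₀ (remove zero π)) π (lift₀-remove π π0≡0))

module _ {n} {v w : Fin n} (adjacent : toℕ w ≡ suc (toℕ v)) where

  private
    swap : Fin n → Fin n
    swap = PC.transpose v w

    v<w : v < w
    v<w rewrite adjacent = ℕ.n<1+n (toℕ v)

  below-adjacent : ∀ {γ} → γ ≢ v → toℕ γ ℕ.< toℕ v ⇔ toℕ γ ℕ.< toℕ w
  below-adjacent γ≢v rewrite adjacent =
    mk⇔ ℕ.m<n⇒m<1+n (λ γ<1+v → ℕ.≤∧≢⇒< (ℕ.s≤s⁻¹ γ<1+v) (γ≢v ∘ toℕ-injective))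

  above-adjacent : ∀ {γ} → γ ≢ w → toℕ v ℕ.< toℕ γ ⇔ toℕ w ℕ.< toℕ γ
  above-adjacent γ≢w rewrite adjacent =
    mk⇔ (λ v<γ → ℕ.≤∧≢⇒< v<γ (λ 1+v≡γ → γ≢w (toℕ-injective (trans (sym 1+v≡γ) (sym adjacent)))))
        (ℕ.<-trans (ℕ.n<1+n (toℕ v)))

  swap-preserves-< : ∀ α β → ¬ (α ≡ v × β ≡ w) → ¬ (α ≡ w × β ≡ v) → α < β ⇔ swap α < swap β
  swap-preserves-< α β ¬vw ¬wv with transposeView v w α | transposeView v w β
  ... | at-i | at-i = mk⇔ (⊥-elim ∘ <-irrefl refl) (⊥-elim ∘ <-irrefl refl)
  ... | at-j | at-j = mk⇔ (⊥-elim ∘ <-irrefl refl) (⊥-elim ∘ <-irrefl refl)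
  ... | at-i | at-j = ⊥-elim (¬vw (refl , refl))
  ... | at-j | at-i = ⊥-elim (¬wv (refl , refl))
  ... | at-i | elsewhere β≢v β≢w
    rewrite transpose-matchˡ v w | transpose-other v w β≢v β≢w = above-adjacent β≢w
  ... | at-j | elsewhere β≢v β≢w
    rewrite transpose-matchʳ v w | transpose-other v w β≢v β≢w = ⇔-sym (above-adjacent β≢w)
  ... | elsewhere α≢v α≢w | at-i
    rewrite transpose-matchˡ v w | transpose-other v w α≢v α≢w = below-adjacent α≢v
  ... | elsewhere α≢v α≢w | at-j
    rewrite transpose-matchʳ v w | transpose-other v w α≢v α≢w = ⇔-sym (below-adjacent α≢v)
  ... | elsewhere α≢v α≢w | elsewhere β≢v β≢w
    rewrite transpose-other v w α≢v α≢w | transpose-other v w β≢v β≢w = ⇔-id _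

  permParity-∘-adjacent : (π : Perm n) → permParity (π ∘ₚ transpose v w) ≡ permParity π ⁻¹
  permParity-∘-adjacent π = by-order (<-cmp P Q)
    where
    f : Fin n → Fin n
    f = π ⟨$⟩ʳ_
    P Q : Fin n
    P = π ⟨$⟩ˡ v
    Q = π ⟨$⟩ˡ w

    at-P : ∀ {i} → f i ≡ v → i ≡ P
    at-P fi≡v = trans (sym (inverseˡ π)) (cong (π ⟨$⟩ˡ_) fi≡v)

    at-Q : ∀ {i} → f i ≡ w → i ≡ Q
    at-Q fi≡w = trans (sym (inverseˡ π)) (cong (π ⟨$⟩ˡ_) fi≡w)

    reversed-v-w : ∀ {i j} → i < j → f i ≡ v → f j ≡ w →
                   does (i <? j) ∧ does (swap (f j) <? swap (f i)) ≡ not (does (i <? j) ∧ does (f j <? f i))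
    reversed-v-w {i} {j} i<j fi≡v fj≡w
      rewrite dec-true (i <? j) i<j | fi≡v | fj≡w | transpose-matchˡ v w | transpose-matchʳ v w
            | dec-true (v <? w) v<w | dec-false (w <? v) (<-asym v<w) = refl

    reversed-w-v : ∀ {i j} → i < j → f i ≡ w → f j ≡ v →
                   does (i <? j) ∧ does (swap (f j) <? swap (f i)) ≡ not (does (i <? j) ∧ does (f j <? f i))
    reversed-w-v {i} {j} i<j fi≡w fj≡v
      rewrite dec-true (i <? j) i<j | fi≡w | fj≡v | transpose-matchˡ v w | transpose-matchʳ v w
            | dec-true (v <? w) v<w | dec-false (w <? v) (<-asym v<w) = refl

    agree : ∀ {e} → (∀ {i j} → i < j → f i ≡ w → f j ≡ v → (i , j) ≡ e) →
                    (∀ {i j} → i < j → f i ≡ v → f j ≡ w → (i , j) ≡ e) →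
            ∀ {i j} → (i , j) ≢ e →
            does (i <? j) ∧ does (swap (f j) <? swap (f i)) ≡ does (i <? j) ∧ does (f j <? f i)
    agree at-w-v at-v-w {i} {j} ij≢e = by-position (i <? j)
      where
      by-position : (i<j? : Dec (i < j)) →
                    does i<j? ∧ does (swap (f j) <? swap (f i)) ≡ does i<j? ∧ does (f j <? f i)
      by-position (no _)    = refl
      by-position (yes i<j) = sym (does-⇔ (swap-preserves-< (f j) (f i)
                                  (λ (fj≡v , fi≡w) → ij≢e (at-w-v i<j fi≡w fj≡v))
                                  (λ (fj≡w , fi≡v) → ij≢e (at-v-w i<j fi≡v fj≡w)))
                                (f j <? f i) (swap (f j) <? swap (f i)))

    by-order : Tri (P < Q) (P ≡ Q) (Q < P) → permParity (π ∘ₚ transpose v w) ≡ permParity π ⁻¹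
    by-order (tri< P<Q _ _) = parity-count-flip (pairs-unique n) (∈-pairs P Q)
      (reversed-v-w P<Q (inverseʳ π) (inverseʳ π))
      (λ {(i , j)} → agree
        (λ i<j fi≡w fj≡v → ⊥-elim (<-asym P<Q (subst₂ _<_ (at-Q fi≡w) (at-P fj≡v) i<j)))
        (λ i<j fi≡v fj≡w → cong₂ _,_ (at-P fi≡v) (at-Q fj≡w)))
    by-order (tri≈ _ P≡Q _) = ⊥-elim (<⇒≢ v<w (trans (sym (inverseʳ π)) (trans (cong f P≡Q) (inverseʳ π))))
    by-order (tri> _ _ Q<P) = parity-count-flip (pairs-unique n) (∈-pairs Q P)
      (reversed-w-v Q<P (inverseʳ π) (inverseʳ π))
      (λ {(i , j)} → agree
        (λ i<j fi≡w fj≡v → cong₂ _,_ (at-Q fi≡w) (at-P fj≡v))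
        (λ i<j fi≡v fj≡w → ⊥-elim (<-asym Q<P (subst₂ _<_ (at-P fi≡v) (at-Q fj≡w) i<j))))

permParity-∘-transpose-gap : ∀ {n} d {i j : Fin n} → toℕ j ≡ d + suc (toℕ i) → (π : Perm n) →
                             permParity (π ∘ₚ transpose i j) ≡ permParity π ⁻¹
permParity-∘-transpose-gap zero    j≡1+i π = permParity-∘-adjacent j≡1+i π
permParity-∘-transpose-gap (suc d) {i} {suc j} 1+j≡1+d+1+i π = begin
  permParity (π ∘ₚ transpose i (suc j))  ≡⟨ permParity-cong (π ∘ₚ transpose i (suc j)) (π′ ∘ₚ t) conjugated ⟩
  permParity (π′ ∘ₚ t)                   ≡⟨ permParity-∘-adjacent c-adjacent π′ ⟩
  permParity π′ ⁻¹                       ≡⟨ cong _⁻¹ (permParity-∘-transpose-gap d c≡d+1+i (π ∘ₚ t)) ⟩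
  permParity (π ∘ₚ t) ⁻¹ ⁻¹              ≡⟨ ⁻¹-involutive (permParity (π ∘ₚ t)) ⟩
  permParity (π ∘ₚ t)                    ≡⟨ permParity-∘-adjacent c-adjacent π ⟩
  permParity π ⁻¹                        ∎
  where
  open ≡-Reasoning
  c : Fin _
  c = inject₁ j

  t : Perm _
  t = transpose c (suc j)

  π′ : Perm _
  π′ = (π ∘ₚ t) ∘ₚ transpose i c

  c≡d+1+i : toℕ c ≡ d + suc (toℕ i)
  c≡d+1+i = trans (toℕ-inject₁ j) (ℕ.suc-injective 1+j≡1+d+1+i)

  c-adjacent : toℕ (suc j) ≡ suc (toℕ c)
  c-adjacent = cong suc (sym (toℕ-inject₁ j))

  i≢c : i ≢ c
  i≢c = <⇒≢ (subst (toℕ i ℕ.<_) (sym c≡d+1+i) (ℕ.m≤n+m _ d))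

  i≢1+j : i ≢ suc j
  i≢1+j = <⇒≢ (subst (toℕ i ℕ.<_) (sym 1+j≡1+d+1+i) (ℕ.m≤n+m _ (suc d)))

  conjugated : π ∘ₚ transpose i (suc j) ≈ π′ ∘ₚ t
  conjugated k = sym (begin
    τ (PC.transpose i c (τ z))          ≡⟨ transpose-conj (transpose-injective c (suc j)) i c (τ z) ⟩
    PC.transpose (τ i) (τ c) (τ (τ z))  ≡⟨ cong (PC.transpose (τ i) (τ c)) (transpose-involutive c (suc j) z) ⟩
    PC.transpose (τ i) (τ c) z          ≡⟨ cong₂ (λ a b → PC.transpose a b z)
                                                 (transpose-other c (suc j) i≢c i≢1+j) (transpose-matchˡ c (suc j)) ⟩
    PC.transpose i (suc j) z            ∎)
    where
    τ : Fin _ → Fin _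
    τ = PC.transpose c (suc j)
    z = π ⟨$⟩ʳ k

permParity-∘-transpose : ∀ {n} {i j : Fin n} → i ≢ j → (π : Perm n) →
                         permParity (π ∘ₚ transpose i j) ≡ permParity π ⁻¹
permParity-∘-transpose {i = i} {j} i≢j π with <-cmp i j
... | tri< i<j _ _ = permParity-∘-transpose-gap _ (sym (ℕ.m∸n+n≡m i<j)) π
... | tri≈ _ i≡j _ = ⊥-elim (i≢j i≡j)
... | tri> _ _ j<i =
  trans (permParity-cong (π ∘ₚ transpose i j) (π ∘ₚ transpose j i) (λ k → transpose-comm i j (π ⟨$⟩ʳ k)))
        (permParity-∘-transpose-gap _ (sym (ℕ.m∸n+n≡m j<i)) π)

record IsCycleFrom {n} (f : Fin n → Fin n) (x : Fin n) : Set where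
  field
    returns         : iter f n x ≡ x
    no-early-return : ∀ {k} → suc k ℕ.< n → iter f (suc k) x ≢ x
    visits-all      : ∀ y → ∃ λ k → k ℕ.< n × iter f k x ≡ y

IsCycle : ∀ {n} → Perm n → Set
IsCycle σ = ∃ (IsCycleFrom (σ ⟨$⟩ʳ_))

IsCycle⇒IsFullCycle : ∀ {n} (σ : Perm n) → IsCycle σ → IsFullCycle σ
IsCycle⇒IsFullCycle _ (x , cycle) = x , IsCycleFrom.visits-all cycle

iter-comm : ∀ {A : Set} (f : A → A) k x → iter f k (f x) ≡ f (iter f k x)
iter-comm f zero    x = refl
iter-comm f (suc k) x = cong f (iter-comm f k x)

module _ {m} {f : Fin (suc m) → Fin (suc m)} (f-injective : Injective _≡_ _≡_ f) where

  isCycleFrom-next : ∀ {x} → IsCycleFrom f x → IsCycleFrom f (f x)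
  isCycleFrom-next {x} cycle = record
    { returns         = trans (iter-comm f (suc m) x) (cong f returns)
    ; no-early-return = λ {k} 1+k<n eq →
        no-early-return 1+k<n (f-injective (trans (sym (iter-comm f (suc k) x)) eq))
    ; visits-all      = visits-all′
    }
    where
    open IsCycleFrom cycle
    visits-all′ : ∀ y → ∃ λ k → k ℕ.< suc m × iter f k (f x) ≡ y
    visits-all′ y with visits-all y
    ... | zero  , _         , x≡y = m , ℕ.n<1+n m , trans (iter-comm f m x) (trans returns x≡y)
    ... | suc k , ℕ.s≤s k<m , eq  = k , ℕ.m<n⇒m<1+n k<m , trans (iter-comm f k x) eq

  isCycleFrom-iter : ∀ {x} → IsCycleFrom f x → ∀ k → IsCycleFrom f (iter f k x)
  isCycleFrom-iter cycle zero    = cycle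
  isCycleFrom-iter cycle (suc k) = isCycleFrom-next (isCycleFrom-iter cycle k)

  isCycleFrom-everywhere : ∀ {x} → IsCycleFrom f x → ∀ y → IsCycleFrom f y
  isCycleFrom-everywhere cycle y with IsCycleFrom.visits-all cycle y
  ... | k , _ , xₖ≡y = subst (IsCycleFrom f) xₖ≡y (isCycleFrom-iter cycle k)

isCycle-Fin1 : (σ : Perm 1) → IsCycle σ
isCycle-Fin1 σ = zero , record
  { returns         = σ0≡0
  ; no-early-return = λ { (ℕ.s≤s ()) }
  ; visits-all      = λ { zero → 0 , ℕ.z<s , refl }
  }
  where
  σ0≡0 : σ ⟨$⟩ʳ zero ≡ zero
  σ0≡0 with σ ⟨$⟩ʳ zero
  ... | zero = refl

-- Splices the new point zero into the cycle of σ: suc a ↦ zero ↦ suc (σ a).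
insertAfter : ∀ {n} → Perm n → Fin n → Perm (suc n)
insertAfter σ a = transpose zero (suc a) ∘ₚ lift₀ σ

module _ {n} (σ : Perm n) (a : Fin n) where

  insertAfter-after : insertAfter σ a ⟨$⟩ʳ suc a ≡ zero
  insertAfter-after = cong (lift₀ σ ⟨$⟩ʳ_) (transpose-matchʳ zero (suc a))

  insertAfter-suc : ∀ {j} → j ≢ a → insertAfter σ a ⟨$⟩ʳ suc j ≡ suc (σ ⟨$⟩ʳ j)
  insertAfter-suc j≢a = cong (lift₀ σ ⟨$⟩ʳ_) (transpose-other zero (suc a) (λ ()) (j≢a ∘ suc-injective))

insertAfter-isCycleFrom : ∀ {m} (σ : Perm (suc m)) {a} → IsCycleFrom (σ ⟨$⟩ʳ_) a →
                          IsCycleFrom (insertAfter σ a ⟨$⟩ʳ_) zero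
insertAfter-isCycleFrom {m} σ {a} cycle = record
  { returns         = trans (cong g (trans (orbit m ℕ.≤-refl) (cong suc returns))) (insertAfter-after σ a)
  ; no-early-return = λ { {k} (ℕ.s≤s k<n) eq → 0≢1+n (trans (sym eq) (orbit k k<n)) }
  ; visits-all      = visits-all′
  }
  where
  open IsCycleFrom cycle
  f : Fin (suc m) → Fin (suc m)
  f = σ ⟨$⟩ʳ_
  g : Fin (2 + m) → Fin (2 + m)
  g = insertAfter σ a ⟨$⟩ʳ_

  orbit : ∀ k → k ℕ.< suc m → iter g (suc k) zero ≡ suc (iter f (suc k) a)
  orbit zero    _               = refl
  orbit (suc k) (ℕ.s≤s 1+k<1+m) =
    trans (cong g (orbit k (ℕ.m<n⇒m<1+n 1+k<1+m))) (insertAfter-suc σ a (no-early-return (ℕ.s≤s 1+k<1+m)))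

  visits-all′ : ∀ y → ∃ λ k → k ℕ.< 2 + m × iter g k zero ≡ y
  visits-all′ zero = 0 , ℕ.z<s , refl
  visits-all′ (suc y) with visits-all y
  ... | zero  , _      , a≡y = suc m , ℕ.n<1+n (suc m) , trans (orbit m ℕ.≤-refl) (cong suc (trans returns a≡y))
  ... | suc k , 1+k<n , eq  =
    suc k , ℕ.m<n⇒m<1+n 1+k<n , trans (orbit k (ℕ.<-trans (ℕ.n<1+n k) 1+k<n)) (cong suc eq)

insertAfter-isCycle : ∀ {m} {σ : Perm (suc m)} → IsCycle σ → ∀ a → IsCycle (insertAfter σ a)
insertAfter-isCycle {σ = σ} (_ , cycle) a =
  zero , insertAfter-isCycleFrom σ (isCycleFrom-everywhere (permute-injective σ) cycle a)

record Factorisation {n} (π : Perm n) : Set where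
  constructor factorisation
  field
    σ τ        : Perm n
    σ-cycle    : IsCycle σ
    τ-cycle    : IsCycle τ
    factorises : Factorises π σ τ

toCycleFactorisation : ∀ {n} {π : Perm n} → Factorisation π → CycleFactorisation π
toCycleFactorisation (factorisation σ τ σ-cycle τ-cycle factorises) =
  (σ , τ) , IsCycle⇒IsFullCycle σ σ-cycle , IsCycle⇒IsFullCycle τ τ-cycle , factorises

lift₀-factorises : ∀ {n} {ρ σ τ : Perm n} → Factorises ρ σ τ →
                   Factorises (lift₀ ρ) (lift₀ σ) (lift₀ τ)
lift₀-factorises fac zero    = refl
lift₀-factorises fac (suc j) = cong suc (fac j)

insertAfter-∘ : ∀ {n} {ρ σ τ : Perm n} → Factorises ρ σ τ → ∀ x d k →
                insertAfter σ (τ ⟨$⟩ʳ x) ⟨$⟩ʳ (insertAfter τ d ⟨$⟩ʳ k)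
                ≡ lift₀ ρ ⟨$⟩ʳ PC.transpose zero (suc x) (PC.transpose zero (suc d) k)
insertAfter-∘ {σ = σ} {τ} fac x d k =
  trans (cong (lift₀ σ ⟨$⟩ʳ_) (sym (transpose-conj (permute-injective (lift₀ τ)) zero (suc x) z)))
        (lift₀-factorises fac (PC.transpose zero (suc x) z))
  where
  z = PC.transpose zero (suc d) k

fixing-zero : ∀ {m} (π : Perm (2 + m)) → π ⟨$⟩ʳ zero ≡ zero → Factorisation (remove zero π) →
              (d : Fin (suc m)) → Σ (Factorisation π) λ φ → Factorisation.τ φ ⟨$⟩ʳ suc d ≡ zero
fixing-zero π π0≡0 (factorisation σ τ σ-cycle τ-cycle fac) d =
  factorisation (insertAfter σ (τ ⟨$⟩ʳ d)) (insertAfter τ d)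
                (insertAfter-isCycle σ-cycle _) (insertAfter-isCycle τ-cycle d) fac′ ,
  insertAfter-after τ d
  where
  open ≡-Reasoning
  ρ : Perm _
  ρ = remove zero π

  fac′ : Factorises π (insertAfter σ (τ ⟨$⟩ʳ d)) (insertAfter τ d)
  fac′ k = begin
    insertAfter σ (τ ⟨$⟩ʳ d) ⟨$⟩ʳ (insertAfter τ d ⟨$⟩ʳ k)
      ≡⟨ insertAfter-∘ fac d d k ⟩
    lift₀ ρ ⟨$⟩ʳ PC.transpose zero (suc d) (PC.transpose zero (suc d) k)
      ≡⟨ cong (lift₀ ρ ⟨$⟩ʳ_) (transpose-involutive zero (suc d) k) ⟩
    lift₀ ρ ⟨$⟩ʳ k
      ≡⟨ lift₀-remove π π0≡0 k ⟩
    π ⟨$⟩ʳ k ∎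

module MovingZero {m} (π : Perm (2 + m)) {w} (π0≡1+w : π ⟨$⟩ʳ zero ≡ suc w) where

  π₀ : Perm (2 + m)
  π₀ = π ∘ₚ transpose zero (suc w)

  π₀-fixes-zero : π₀ ⟨$⟩ʳ zero ≡ zero
  π₀-fixes-zero = trans (cong (PC.transpose zero (suc w)) π0≡1+w) (transpose-matchʳ zero (suc w))

  ρ : Perm (suc m)
  ρ = remove zero π₀

  x : Fin (suc m)
  x = ρ ⟨$⟩ˡ w

  π-via-ρ : ∀ k → π ⟨$⟩ʳ k ≡ PC.transpose zero (suc w) (lift₀ ρ ⟨$⟩ʳ k)
  π-via-ρ k = trans (sym (transpose-involutive zero (suc w) (π ⟨$⟩ʳ k)))
                    (cong (PC.transpose zero (suc w)) (sym (lift₀-remove π₀ π₀-fixes-zero k)))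

  π-1+x : π ⟨$⟩ʳ suc x ≡ zero
  π-1+x = trans (π-via-ρ (suc x))
                (trans (cong (λ y → PC.transpose zero (suc w) (suc y)) (inverseʳ ρ)) (transpose-matchʳ zero (suc w)))

  permParity-ρ : permParity ρ ≡ permParity π ⁻¹
  permParity-ρ = trans (permParity-remove-zero π₀ π₀-fixes-zero) (permParity-∘-transpose (λ ()) π)

  module _ (d : Fin (suc m)) (d≢x : d ≢ x) where

    ρ′ : Perm (suc m)
    ρ′ = transpose x d ∘ₚ ρ

    permParity-ρ′ : permParity ρ′ ≡ permParity π
    permParity-ρ′ = begin
      permParity ρ′                             ≡⟨ permParity-cong ρ′ (ρ ∘ₚ transpose w (ρ ⟨$⟩ʳ d)) conjugated ⟩
      permParity (ρ ∘ₚ transpose w (ρ ⟨$⟩ʳ d))  ≡⟨ permParity-∘-transpose w≢ρd ρ ⟩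
      permParity ρ ⁻¹                           ≡⟨ cong _⁻¹ permParity-ρ ⟩
      permParity π ⁻¹ ⁻¹                        ≡⟨ ⁻¹-involutive (permParity π) ⟩
      permParity π                              ∎
      where
      open ≡-Reasoning
      conjugated : ρ′ ≈ ρ ∘ₚ transpose w (ρ ⟨$⟩ʳ d)
      conjugated k = trans (transpose-conj (permute-injective ρ) x d k)
                           (cong (λ y → PC.transpose y (ρ ⟨$⟩ʳ d) (ρ ⟨$⟩ʳ k)) (inverseʳ ρ))

      w≢ρd : w ≢ ρ ⟨$⟩ʳ d
      w≢ρd w≡ρd = d≢x (trans (sym (inverseˡ ρ)) (cong (ρ ⟨$⟩ˡ_) (sym w≡ρd)))

    moving-zero : Factorisation ρ′ → Σ (Factorisation π) λ φ → Factorisation.τ φ ⟨$⟩ʳ suc d ≡ zero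
    moving-zero (factorisation σ τ σ-cycle τ-cycle fac) =
      factorisation (insertAfter σ (τ ⟨$⟩ʳ x)) (insertAfter τ d)
                    (insertAfter-isCycle σ-cycle _) (insertAfter-isCycle τ-cycle d) fac′ ,
      insertAfter-after τ d
      where
      open ≡-Reasoning
      fac′ : Factorises π (insertAfter σ (τ ⟨$⟩ʳ x)) (insertAfter τ d)
      fac′ k = begin
        insertAfter σ (τ ⟨$⟩ʳ x) ⟨$⟩ʳ (insertAfter τ d ⟨$⟩ʳ k)
          ≡⟨ insertAfter-∘ fac x d k ⟩
        lift₀ ρ′ ⟨$⟩ʳ T₀ₓ (T₀d k)
          ≡⟨ lift₀-comp (transpose x d) ρ _ ⟨
        lift₀ ρ ⟨$⟩ʳ (lift₀ (transpose x d) ⟨$⟩ʳ T₀ₓ (T₀d k))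
          ≡⟨ cong (lift₀ ρ ⟨$⟩ʳ_) (lift₀-transpose x d _) ⟨
        lift₀ ρ ⟨$⟩ʳ Tₓd (T₀ₓ (T₀d k))
          ≡⟨ cong (λ y → lift₀ ρ ⟨$⟩ʳ Tₓd y) (transpose-∘-transpose (λ ()) (d≢x ∘ suc-injective) k) ⟩
        lift₀ ρ ⟨$⟩ʳ Tₓd (Tₓd (T₀ₓ k))
          ≡⟨ cong (lift₀ ρ ⟨$⟩ʳ_) (transpose-involutive (suc x) (suc d) (T₀ₓ k)) ⟩
        lift₀ ρ ⟨$⟩ʳ T₀ₓ k
          ≡⟨ transpose-conj (permute-injective (lift₀ ρ)) zero (suc x) k ⟩
        PC.transpose zero (suc (ρ ⟨$⟩ʳ x)) (lift₀ ρ ⟨$⟩ʳ k)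
          ≡⟨ cong (λ y → PC.transpose zero (suc y) (lift₀ ρ ⟨$⟩ʳ k)) (inverseʳ ρ) ⟩
        PC.transpose zero (suc w) (lift₀ ρ ⟨$⟩ʳ k)
          ≡⟨ π-via-ρ k ⟨
        π ⟨$⟩ʳ k ∎
        where
        T₀ₓ T₀d Tₓd : Fin (2 + m) → Fin (2 + m)
        T₀ₓ = PC.transpose zero (suc x)
        T₀d = PC.transpose zero (suc d)
        Tₓd = PC.transpose (suc x) (suc d)

factorisation-step : ∀ {m} → (∀ (ρ : Perm (suc m)) → permParity ρ ≡ 0ℙ → Factorisation ρ) →
                     (π : Perm (2 + m)) → permParity π ≡ 0ℙ → (d : Fin (suc m)) → π ⟨$⟩ʳ suc d ≢ zero →
                     Σ (Factorisation π) λ φ → Factorisation.τ φ ⟨$⟩ʳ suc d ≡ zero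
factorisation-step factorise π even d π1+d≢0 = by-image-of-zero _ refl
  where
  by-image-of-zero : ∀ z → π ⟨$⟩ʳ zero ≡ z → Σ (Factorisation π) λ φ → Factorisation.τ φ ⟨$⟩ʳ suc d ≡ zero
  by-image-of-zero zero    π0≡0   =
    fixing-zero π π0≡0 (factorise (remove zero π) (trans (permParity-remove-zero π π0≡0) even)) d
  by-image-of-zero (suc w) π0≡1+w =
    moving-zero d d≢x (factorise (ρ′ d d≢x) (trans (permParity-ρ′ d d≢x) even))
    where
    open MovingZero π π0≡1+w
    d≢x : d ≢ x
    d≢x d≡x = π1+d≢0 (subst (λ y → π ⟨$⟩ʳ suc y ≡ zero) (sym d≡x) π-1+x)

image-nonzero : ∀ {n} (π : Perm (suc n)) {i j} → π ⟨$⟩ʳ i ≡ zero → j ≢ i → π ⟨$⟩ʳ j ≢ zero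
image-nonzero π πi≡0 j≢i πj≡0 = j≢i (permute-injective π (trans πj≡0 (sym πi≡0)))

some-image-nonzero : ∀ {m} (π : Perm (2 + m)) → permParity π ≡ 0ℙ → ∃ λ d → π ⟨$⟩ʳ suc d ≢ zero
some-image-nonzero {zero} π even = by-image-of-zero _ refl
  where
  by-image-of-zero : ∀ z → π ⟨$⟩ʳ zero ≡ z → ∃ λ d → π ⟨$⟩ʳ suc d ≢ zero
  by-image-of-zero zero    π0≡0   = zero , image-nonzero π π0≡0 (λ ())
  -- A permutation of Fin 2 moving zero is the odd transposition.
  by-image-of-zero (suc w) π0≡1+w =
    ⊥-elim (p≢p⁻¹ (permParity π) (trans even (trans (sym (permParity-Fin1 ρ)) permParity-ρ)))
    where open MovingZero π π0≡1+w
some-image-nonzero {suc m} π _ with π ⟨$⟩ʳ 1F ≟ zero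
... | no  π1≢0 = 0F , π1≢0
... | yes π1≡0 = 1F , image-nonzero π π1≡0 (λ ())

factorisation-of-even : ∀ m (π : Perm (suc m)) → permParity π ≡ 0ℙ → Factorisation π
factorisation-of-even zero    π _    = factorisation id π (isCycle-Fin1 id) (isCycle-Fin1 π) (λ _ → refl)
factorisation-of-even (suc m) π even with some-image-nonzero π even
... | d , π1+d≢0 = proj₁ (factorisation-step (factorisation-of-even m) π even d π1+d≢0)

two-images-nonzero : ∀ {k} (π : Perm (4 + k)) →
                     Σ (Fin (3 + k)) λ d₁ → Σ (Fin (3 + k)) λ d₂ →
                       d₁ ≢ d₂ × π ⟨$⟩ʳ suc d₁ ≢ zero × π ⟨$⟩ʳ suc d₂ ≢ zero
two-images-nonzero π with π ⟨$⟩ʳ 1F ≟ zero | π ⟨$⟩ʳ 2F ≟ zero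
... | yes π1≡0 | _        = 1F , 2F , (λ ()) , image-nonzero π π1≡0 (λ ()) , image-nonzero π π1≡0 (λ ())
... | no  π1≢0 | yes π2≡0 = 0F , 2F , (λ ()) , π1≢0 , image-nonzero π π2≡0 (λ ())
... | no  π1≢0 | no  π2≢0 = 0F , 1F , (λ ()) , π1≢0 , π2≢0

corollary3p2 : (n : ℕ) → 4 ≤ n → (π : Perm n) → IsEven π →
    Σ (CycleFactorisation π) λ f₁ → Σ (CycleFactorisation π) λ f₂ →
      ¬ ((proj₁ (proj₁ f₁) ≐ proj₁ (proj₁ f₂)) × (proj₂ (proj₁ f₁) ≐ proj₂ (proj₁ f₂)))
corollary3p2 _ (ℕ.s≤s (ℕ.s≤s (ℕ.s≤s (ℕ.s≤s _)))) π isEven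
  with two-images-nonzero π
... | d₁ , d₂ , d₁≢d₂ , π1+d₁≢0 , π1+d₂≢0
  with factorisation-step (factorisation-of-even _) π (isEven⇒permParity≡0 π isEven) d₁ π1+d₁≢0
     | factorisation-step (factorisation-of-even _) π (isEven⇒permParity≡0 π isEven) d₂ π1+d₂≢0
... | φ₁ , τ₁-1+d₁≡0 | φ₂ , τ₂-1+d₂≡0 =
  toCycleFactorisation φ₁ , toCycleFactorisation φ₂ , λ (_ , τ₁≐τ₂) →
    d₁≢d₂ (suc-injective (permute-injective (Factorisation.τ φ₂)
      (trans (sym (τ₁≐τ₂ (suc d₁))) (trans τ₁-1+d₁≡0 (sym τ₂-1+d₂≡0)))))
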